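{- Let $n\ge3$, $k\in\mathbb{Z}_{\ge0}$, and let $\mathbf w=[w_1,w_2,\dots]$ be an infinite sequence in $\{1,\dots,n\}$ with $w_{t+1}\ne w_t$ for all $t$, in which every index occurs infinitely often. Let ${}_0x\in\mathbb{Z}_{>0}^n$, ${}_0y\in\mathbb{Z}_{\ge0}^n$, and define ${}_{t+1}x=\mathcal M_{w_{t+1};0}({}_tx)$, ${}_{t+1}y=\mathcal M_{w_{t+1};k}({}_ty)$. Let ${}_tl_j={}_ty_j/{}_tx_j$ and ${}_tL=[\min_j {}_tl_j,\ \max_j {}_tl_j]$. Then the intervals ${}_tL$ converge to a point: there is $q\in\mathbb{R}$ with $\min_j{}_tl_j\to q$ and $\max_j{}_tl_j\to q$ as $t\to\infty$.
   Context: For $k\ge 0$ and $i\in\{1,\dots,n\}$, $\mathcal M_{i;k}(z_1,\dots,z_n)$ is obtained from $(z_1,\dots,z_n)$ by replacing $z_i$ with $z_1+\cdots+\widehat{z_i}+\cdots+z_n+k$ (omitting $z_i$ from the sum) and keeping the other coordinates. -}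

module Defs where

open import Data.Nat using (ℕ; zero; suc; _+_; pred)
open import Data.Fin using (Fin; zero; suc; _≟_)
open import Data.Integer using (+_)
open import Data.Rational using (ℚ; _/_; _⊓_; _⊔_; 0ℚ)
open import Relation.Nullary using (yes; no)

sumFin : ∀ {n} → (Fin n → ℕ) → ℕ
sumFin {zero}  z = 0
sumFin {suc n} z = z zero + sumFin (λ j → z (suc j))

sumExcept : ∀ {n} → Fin n → (Fin n → ℕ) → ℕ
sumExcept i z = sumFin (λ j → f j (j ≟ i))
  where
    f : ∀ j → _ → ℕ
    f j (yes _) = 0
    f j (no _)  = z j

M : ∀ {n} → Fin n → ℕ → (Fin n → ℕ) → (Fin n → ℕ)
M i k z j with j ≟ i
... | yes _ = sumExcept i z + k
... | no _  = z j

-- orbit: orbit w z0 0 = z0, orbit w z0 (t+1) = M_{w t;k}(orbit t).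
-- Here w t stands for the paper's w_{t+1}.
orbit : ∀ {n} → (ℕ → Fin n) → ℕ → (Fin n → ℕ) → ℕ → (Fin n → ℕ)
orbit w k z0 zero    = z0
orbit w k z0 (suc t) = M (w t) k (orbit w k z0 t)

-- the rational y / x; the denominator is written suc (pred x), which equals x
-- whenever x > 0 (all x-coordinates stay positive along the orbit).
ratio : ℕ → ℕ → ℚ
ratio y x = (+ y) / suc (pred x)

-- minimum / maximum over Fin n (the value for n = 0 is irrelevant; n ≥ 3 below)
minFin : ∀ {n} → (Fin n → ℚ) → ℚ
minFin {zero} f = 0ℚ
minFin {suc zero} f = f zero
minFin {suc (suc n)} f = f zero ⊓ minFin (λ j → f (suc j))

maxFin : ∀ {n} → (Fin n → ℚ) → ℚ
maxFin {zero} f = 0ℚ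
maxFin {suc zero} f = f zero
maxFin {suc (suc n)} f = f zero ⊔ maxFin (λ j → f (suc j))

-- Shifting y by c = k/(n-2) turns every M_{i;k} into M_{i;0}: with X = x and Y = y + c
-- both sequences evolve under the same linear and monotone maps, so once every ratio Y_j/X_j
-- lies in an interval [a, b] it stays there. Suppose the index p has just been mutated and
-- then every other index is mutated while p is not. Right after the mutation X_p is the sum of
-- the other coordinates, and comparing X with the vector H that is X with its p-th coordinate
-- cut out shows that H contributes at most half of X at the end of the stretch. Writing
-- v = Y_p/X_p, the vector Y - vX vanishes at p and is squeezed between (a - v)H and (b - v)H,
-- so the interval shrinks to [(a + v)/2, (b + v)/2]. Over the same stretch every coordinate of
-- X is replaced by a sum of at least two others, so the least coordinate of X doubles. Every
-- index recurring yields infinitely many such stretches; hence the intervals for Y/X shrink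
-- geometrically, and y/x = Y/X - c/x is within c/min X -> 0 of them.
module Submission where

open import Level using (0ℓ)
open import Function.Base using (_∘_)
open import Data.Empty using (⊥-elim)
open import Data.Maybe.Base using (Maybe; just; nothing)
open import Data.Product using (Σ; ∃-syntax; _×_; _,_; proj₁; proj₂)
open import Data.Sum using (_⊎_; inj₁; inj₂)
open import Data.Nat as ℕ using (ℕ; zero; suc; z≤n; s≤s; ≤′-refl; ≤′-step)
import Data.Nat.Properties as ℕ
open import Data.Fin using (Fin; zero; suc; _≟_; punchIn)
open import Data.Fin.Properties using (punchInᵢ≢i; all?; ¬∀⟶∃¬)
import Data.Integer as ℤ
import Data.Integer.Properties as ℤ
open import Data.Rational
  using (ℚ; mkℚ; 0ℚ; 1ℚ; ½; _+_; _*_; _-_; -_; ∣_∣; _≤_; _<_; ↥_; *≤*; NonZero; >-nonZero; 1/_;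
         nonNegative; nonPositive; positive)
open import Data.Rational.Literals using (fromℤ)
open import Data.Rational.Properties renaming (_≟_ to _≟ℚ_)
open import Data.Rational.Unnormalised as ℚᵘ using (mkℚᵘ; *≡*)
import Data.Rational.Unnormalised.Properties as ℚᵘ
open import Data.Vec.Functional using (Vector; removeAt; updateAt)
open import Data.Vec.Functional.Properties using (updateAt-updates; updateAt-minimal)
open import Algebra.Bundles using (CommutativeRing)
open import Algebra.Properties.Semiring.Sum (CommutativeRing.semiring +-*-commutativeRing)
  using (sum; sum-cong-≗; sum-remove; ∑-distrib-+; *-distribˡ-sum)
open import Relation.Nullary using (¬_; Dec; yes; no)
open import Relation.Binary.PropositionalEquality
open import Tactic.RingSolver using (solve-∀)
import Tactic.RingSolver.Core.AlmostCommutativeRing as ACR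
open import Defs

ℚ-ring : ACR.AlmostCommutativeRing 0ℓ 0ℓ
ℚ-ring = ACR.fromCommutativeRing +-*-commutativeRing isZero
  where
  isZero : ∀ p → Maybe (0ℚ ≡ p)
  isZero p with 0ℚ ≟ℚ p
  ... | yes eq = just eq
  ... | no  _  = nothing

p≤q⇒0≤q-p : ∀ {p q} → p ≤ q → 0ℚ ≤ q - p
p≤q⇒0≤q-p {p} {q} p≤q = ≤-trans (≤-reflexive (sym (+-inverseʳ p))) (+-monoˡ-≤ (- p) p≤q)

0≤q-p⇒p≤q : ∀ {p q} → 0ℚ ≤ q - p → p ≤ q
0≤q-p⇒p≤q {p} {q} 0≤q-p = begin
  p               ≡⟨ +-identityˡ p ⟨
  0ℚ + p          ≤⟨ +-monoˡ-≤ p 0≤q-p ⟩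
  q - p + p       ≡⟨ sub-add q p ⟩
  q               ∎
  where
  open ≤-Reasoning
  sub-add : ∀ a b → a - b + b ≡ a
  sub-add = solve-∀ ℚ-ring

p≤q⇒p-q≤0 : ∀ {p q} → p ≤ q → p - q ≤ 0ℚ
p≤q⇒p-q≤0 {p} {q} p≤q = ≤-trans (+-monoˡ-≤ (- q) p≤q) (≤-reflexive (+-inverseʳ q))

p≤p+q : ∀ {p q} → 0ℚ ≤ q → p ≤ p + q
p≤p+q {p} {q} 0≤q = ≤-trans (≤-reflexive (sym (+-identityʳ p))) (+-monoʳ-≤ p 0≤q)

nonNeg-* : ∀ {p q} → 0ℚ ≤ p → 0ℚ ≤ q → 0ℚ ≤ p * q
nonNeg-* {p} {q} 0≤p 0≤q =
  nonNegative⁻¹ (p * q) {{nonNeg*nonNeg⇒nonNeg p {{nonNegative 0≤p}} q {{nonNegative 0≤q}}}}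

-- Unlike ℤ.+ m / 1, fromℤ involves no normalisation: toℚᵘ (fromℕ m) computes to mkℚᵘ (ℤ.+ m) 0.
fromℕ : ℕ → ℚ
fromℕ m = fromℤ (ℤ.+ m)

fromℕ-+ : ∀ m n → fromℕ (m ℕ.+ n) ≡ fromℕ m + fromℕ n
fromℕ-+ m n = toℚᵘ-injective (ℚᵘ.≃-trans (*≡* eq) (ℚᵘ.≃-sym (toℚᵘ-homo-+ (fromℕ m) (fromℕ n))))
  where
  eq : ℤ.+ (m ℕ.+ n) ℤ.* ℤ.+ 1 ≡ (ℤ.+ m ℤ.* ℤ.+ 1 ℤ.+ ℤ.+ n ℤ.* ℤ.+ 1) ℤ.* ℤ.+ 1
  eq = cong (ℤ._* ℤ.+ 1) (trans (ℤ.pos-+ m n)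
         (sym (cong₂ ℤ._+_ (ℤ.*-identityʳ (ℤ.+ m)) (ℤ.*-identityʳ (ℤ.+ n)))))

fromℕ-nonNeg : ∀ m → 0ℚ ≤ fromℕ m
fromℕ-nonNeg m = nonNegative⁻¹ (fromℕ m)

1≤fromℕ : ∀ {m} → 0 ℕ.< m → 1ℚ ≤ fromℕ m
1≤fromℕ {suc m} _ = ≤-trans (p≤p+q (fromℕ-nonNeg m)) (≤-reflexive (sym (fromℕ-+ 1 m)))

ratio-*-fromℕ : ∀ y x → 0 ℕ.< x → ratio y x * fromℕ x ≡ fromℕ y
ratio-*-fromℕ y (suc d) _ = toℚᵘ-injective (ℚᵘ.≃-trans (toℚᵘ-homo-* (ratio y (suc d)) (fromℕ (suc d)))
  (ℚᵘ.≃-trans (ℚᵘ.*-congʳ (toℚᵘ-fromℚᵘ (mkℚᵘ (ℤ.+ y) d))) (*≡* eq)))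
  where
  eq : (ℤ.+ y ℤ.* ℤ.+ suc d) ℤ.* ℤ.+ 1 ≡ ℤ.+ y ℤ.* ℤ.+ (suc d ℕ.* 1)
  eq = trans (ℤ.*-identityʳ _) (cong (λ e → ℤ.+ y ℤ.* ℤ.+ e) (sym (ℕ.*-identityʳ (suc d))))

≤-fromℕ∣↥∣ : ∀ p → p ≤ fromℕ ℤ.∣ ↥ p ∣
≤-fromℕ∣↥∣ (mkℚ (ℤ.+ a) d _) =
  *≤* (subst₂ ℤ._≤_ (sym (ℤ.*-identityʳ (ℤ.+ a))) (ℤ.pos-* a (suc d)) (ℤ.+≤+ (ℕ.m≤m*n a (suc d))))
≤-fromℕ∣↥∣ (mkℚ ℤ.-[1+ a ] d _) =
  *≤* (subst (ℤ._≤ ℤ.+ suc a ℤ.* ℤ.+ suc d) (sym (ℤ.*-identityʳ ℤ.-[1+ a ])) ℤ.-≤+)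

½^_ : ℕ → ℚ
½^ zero  = 1ℚ
½^ suc r = ½ * ½^ r

½^-nonNeg : ∀ r → 0ℚ ≤ ½^ r
½^-nonNeg zero    = nonNegative⁻¹ 1ℚ
½^-nonNeg (suc r) = nonNeg-* (nonNegative⁻¹ ½) (½^-nonNeg r)

½^≤1 : ∀ r → ½^ r ≤ 1ℚ
½^≤1 zero    = ≤-refl
½^≤1 (suc r) = ≤-trans (*-monoˡ-≤-nonNeg ½ (½^≤1 r)) (*≤* (ℤ.+≤+ (s≤s z≤n)))

fromℕ*½^<1 : ∀ r → fromℕ r * ½^ r < 1ℚ
fromℕ*½^<1 zero    = positive⁻¹ 1ℚ
fromℕ*½^<1 (suc r) = begin-strict
  fromℕ (suc r) * (½ * ½^ r)             ≡⟨ cong (_* (½ * ½^ r)) (fromℕ-+ 1 r) ⟩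
  (1ℚ + fromℕ r) * (½ * ½^ r)            ≡⟨ regroup (fromℕ r) (½^ r) ⟩
  ½ * ½^ r + ½ * (fromℕ r * ½^ r)        <⟨ +-mono-≤-< (*-monoˡ-≤-nonNeg ½ (½^≤1 r))
                                                          (*-monoʳ-<-pos ½ (fromℕ*½^<1 r)) ⟩
  ½ * 1ℚ + ½ * 1ℚ                        ≡⟨⟩
  1ℚ                                     ∎
  where
  open ≤-Reasoning
  regroup : ∀ x h → (1ℚ + x) * (½ * h) ≡ ½ * h + ½ * (x * h)
  regroup = solve-∀ ℚ-ring

midpoints-narrow : ∀ {lo hi K r} v → hi - lo ≤ K * ½^ r → (hi + v) * ½ - (lo + v) * ½ ≤ K * ½^ suc r
midpoints-narrow {lo} {hi} {K} {r} v narrow = begin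
  (hi + v) * ½ - (lo + v) * ½   ≡⟨ shrink hi lo v ⟩
  ½ * (hi - lo)                 ≤⟨ *-monoˡ-≤-nonNeg ½ narrow ⟩
  ½ * (K * ½^ r)                ≡⟨ swap K (½^ r) ⟩
  K * (½ * ½^ r)                ∎
  where
  open ≤-Reasoning
  shrink : ∀ hi lo v → (hi + v) * ½ - (lo + v) * ½ ≡ ½ * (hi - lo)
  shrink = solve-∀ ℚ-ring
  swap : ∀ a b → ½ * (a * b) ≡ a * (½ * b)
  swap = solve-∀ ℚ-ring

archimedean : ∀ Q {ε} → 0ℚ < ε → ∃[ r ] Q * ½^ r < ε
archimedean Q {ε} 0<ε = N , (begin-strict
  Q * ½^ N                  ≡⟨ cong (_* ½^ N) Q≡Rε ⟩
  R * ε * ½^ N              ≡⟨ regroup R ε (½^ N) ⟩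
  ε * (R * ½^ N)            ≤⟨ *-monoˡ-≤-nonNeg ε {{nonNegative (<⇒≤ 0<ε)}}
                                 (*-monoʳ-≤-nonNeg (½^ N) {{nonNegative (½^-nonNeg N)}} (≤-fromℕ∣↥∣ R)) ⟩
  ε * (fromℕ N * ½^ N)      <⟨ *-monoʳ-<-pos ε {{positive 0<ε}} (fromℕ*½^<1 N) ⟩
  ε * 1ℚ                    ≡⟨ *-identityʳ ε ⟩
  ε                         ∎)
  where
  open ≤-Reasoning
  instance
    ε≢0 : NonZero ε
    ε≢0 = >-nonZero 0<ε
  R = Q * 1/ ε
  N = ℤ.∣ ↥ R ∣
  Q≡Rε : Q ≡ R * ε
  Q≡Rε = sym (trans (*-assoc Q (1/ ε) ε) (trans (cong (Q *_) (*-inverseˡ ε)) (*-identityʳ Q)))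
  regroup : ∀ r e h → r * e * h ≡ e * (r * h)
  regroup = solve-∀ ℚ-ring

infix 4 _∈[_,_]

_∈[_,_] : ℚ → ℚ → ℚ → Set
x ∈[ a , b ] = a ≤ x × x ≤ b

minFin-∈ : ∀ {n a b} {f : Fin (suc n) → ℚ} → (∀ j → f j ∈[ a , b ]) → minFin f ∈[ a , b ]
minFin-∈ {zero}  f∈ = f∈ zero
minFin-∈ {suc n} {f = f} f∈ with minFin-∈ (f∈ ∘ suc)
... | a≤min , _ = ⊓-glb (proj₁ (f∈ zero)) a≤min , ≤-trans (p⊓q≤p (f zero) _) (proj₂ (f∈ zero))

maxFin-∈ : ∀ {n a b} {f : Fin (suc n) → ℚ} → (∀ j → f j ∈[ a , b ]) → maxFin f ∈[ a , b ]
maxFin-∈ {zero}  f∈ = f∈ zero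
maxFin-∈ {suc n} {f = f} f∈ with maxFin-∈ (f∈ ∘ suc)
... | _ , max≤b = ≤-trans (proj₁ (f∈ zero)) (p≤p⊔q (f zero) _) , ⊔-lub (proj₂ (f∈ zero)) max≤b

∣-∣≤width : ∀ {x y a b} → x ∈[ a , b ] → y ∈[ a , b ] → ∣ x - y ∣ ≤ b - a
∣-∣≤width {x} {y} {a} {b} (a≤x , x≤b) (a≤y , y≤b) with ∣p∣≡p∨∣p∣≡-p (x - y)
... | inj₁ ∣x-y∣≡x-y = ≤-trans (≤-reflexive ∣x-y∣≡x-y) (+-mono-≤ x≤b (neg-antimono-≤ a≤y))
... | inj₂ ∣x-y∣≡y-x = ≤-trans (≤-reflexive (trans ∣x-y∣≡y-x (swap x y)))
                               (+-mono-≤ y≤b (neg-antimono-≤ a≤x))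
  where
  swap : ∀ x y → - (x - y) ≡ y - x
  swap = solve-∀ ℚ-ring

infix 4 _≤ᵛ_
infixl 7 _*ᵛ_

_≤ᵛ_ : ∀ {n} → Vector ℚ n → Vector ℚ n → Set
F ≤ᵛ G = ∀ j → F j ≤ G j

_*ᵛ_ : ∀ {n} → ℚ → Vector ℚ n → Vector ℚ n
(a *ᵛ F) j = a * F j

sum-mono : ∀ {n} {F G : Vector ℚ n} → F ≤ᵛ G → sum F ≤ sum G
sum-mono {zero}  F≤G = ≤-refl
sum-mono {suc n} F≤G = +-mono-≤ (F≤G zero) (sum-mono (F≤G ∘ suc))

sum-nonNeg : ∀ {n} {F : Vector ℚ n} → (∀ j → 0ℚ ≤ F j) → 0ℚ ≤ sum F
sum-nonNeg {zero}  _   = ≤-refl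
sum-nonNeg {suc n} 0≤F = +-mono-≤ (0≤F zero) (sum-nonNeg (0≤F ∘ suc))

≤-sum : ∀ {n} {F : Vector ℚ n} → (∀ j → 0ℚ ≤ F j) → ∀ i → F i ≤ sum F
≤-sum {suc n} {F} 0≤F zero    = p≤p+q (sum-nonNeg (0≤F ∘ suc))
≤-sum {suc n} {F} 0≤F (suc i) = ≤-trans (≤-reflexive (sym (+-identityˡ (F (suc i)))))
                                        (+-mono-≤ (0≤F zero) (≤-sum (0≤F ∘ suc) i))

1+1≤sum : ∀ {n} {G : Vector ℚ (suc (suc n))} → (∀ j → 1ℚ ≤ G j) → 1ℚ + 1ℚ ≤ sum G
1+1≤sum 1≤G = +-mono-≤ (1≤G zero) (≤-trans (1≤G (suc zero)) (p≤p+q (sum-nonNeg 0≤rest)))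
  where
  0≤rest = λ j → ≤-trans (nonNegative⁻¹ 1ℚ) (1≤G (suc (suc j)))

sum-const : ∀ n c → sum {n} (λ _ → c) ≡ fromℕ n * c
sum-const zero    c = sym (*-zeroˡ c)
sum-const (suc n) c = begin
  c + sum {n} (λ _ → c)    ≡⟨ cong (c +_) (sum-const n c) ⟩
  c + fromℕ n * c          ≡⟨ cong (_+ fromℕ n * c) (*-identityˡ c) ⟨
  1ℚ * c + fromℕ n * c     ≡⟨ *-distribʳ-+ c 1ℚ (fromℕ n) ⟨
  (1ℚ + fromℕ n) * c       ≡⟨ cong (_* c) (fromℕ-+ 1 n) ⟨
  fromℕ (suc n) * c        ∎
  where open ≡-Reasoning

sum-linear : ∀ {n} a b (F G : Vector ℚ n) → sum (λ j → a * F j + b * G j) ≡ a * sum F + b * sum G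
sum-linear a b F G = trans (∑-distrib-+ (a *ᵛ F) (b *ᵛ G))
                           (sym (cong₂ _+_ (*-distribˡ-sum a F) (*-distribˡ-sum b G)))

sum-removeAt : ∀ {n} (F : Vector ℚ (suc n)) i → sum (removeAt F i) ≡ sum F - F i
sum-removeAt F i = begin
  sum (removeAt F i)                   ≡⟨ add-sub (F i) (sum (removeAt F i)) ⟨
  F i + sum (removeAt F i) - F i       ≡⟨ cong (_- F i) (sum-remove F) ⟨
  sum F - F i                          ∎
  where
  open ≡-Reasoning
  add-sub : ∀ a b → a + b - a ≡ b
  add-sub = solve-∀ ℚ-ring

mutate : ∀ {n} → Fin (suc n) → Vector ℚ (suc n) → Vector ℚ (suc n)
mutate i F j with j ≟ i
... | yes _ = sum (removeAt F i)
... | no  _ = F j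

module _ {n : ℕ} {i : Fin (suc n)} where

  mutate-updates : ∀ F → mutate i F i ≡ sum (removeAt F i)
  mutate-updates F with i ≟ i
  ... | yes _   = refl
  ... | no  i≢i = ⊥-elim (i≢i refl)

  mutate-minimal : ∀ {j} F → j ≢ i → mutate i F j ≡ F j
  mutate-minimal {j} F j≢i with j ≟ i
  ... | yes j≡i = ⊥-elim (j≢i j≡i)
  ... | no  _   = refl

  sum-removeAt-mutate : ∀ F → sum (removeAt (mutate i F) i) ≡ sum (removeAt F i)
  sum-removeAt-mutate F = sum-cong-≗ (mutate-minimal F ∘ punchInᵢ≢i i)

  mutate-cong : ∀ {F G} → F ≗ G → mutate i F ≗ mutate i G
  mutate-cong F≗G j with j ≟ i
  ... | yes _ = sum-cong-≗ (F≗G ∘ punchIn i)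
  ... | no  _ = F≗G j

  mutate-mono : ∀ {F G} → F ≤ᵛ G → mutate i F ≤ᵛ mutate i G
  mutate-mono F≤G j with j ≟ i
  ... | yes _ = sum-mono (F≤G ∘ punchIn i)
  ... | no  _ = F≤G j

  mutate-* : ∀ a F → mutate i (a *ᵛ F) ≗ a *ᵛ mutate i F
  mutate-* a F j with j ≟ i
  ... | yes _ = sym (*-distribˡ-sum a (removeAt F i))
  ... | no  _ = refl

  mutate-linear : ∀ a b F G →
    mutate i (λ j → a * F j + b * G j) ≗ (λ j → a * mutate i F j + b * mutate i G j)
  mutate-linear a b F G j with j ≟ i
  ... | yes _ = sum-linear a b (removeAt F i) (removeAt G i)
  ... | no  _ = refl

evolve : ∀ {n} → (ℕ → Fin (suc n)) → ℕ → Vector ℚ (suc n) → Vector ℚ (suc n)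
evolve u zero    F = F
evolve u (suc t) F = mutate (u t) (evolve u t F)

Occurs : ∀ {A : Set} → (ℕ → A) → ℕ → A → Set
Occurs u d a = ∃[ t ] t ℕ.< d × u t ≡ a

occurs-before-last : ∀ {A : Set} {u : ℕ → A} {t a} → Occurs u (suc t) a → a ≢ u t → Occurs u t a
occurs-before-last (t′ , t′≤t , refl) a≢ut with ℕ.m≤n⇒m<n∨m≡n (ℕ.≤-pred t′≤t)
... | inj₁ t′<t = t′ , t′<t , refl
... | inj₂ refl = ⊥-elim (a≢ut refl)

module _ {n : ℕ} (u : ℕ → Fin (suc n)) where

  evolve-mono : ∀ {F G} → F ≤ᵛ G → ∀ t → evolve u t F ≤ᵛ evolve u t G
  evolve-mono F≤G zero    = F≤G
  evolve-mono F≤G (suc t) = mutate-mono (evolve-mono F≤G t)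

  evolve-linear : ∀ a b F G t →
    evolve u t (λ j → a * F j + b * G j) ≗ (λ j → a * evolve u t F j + b * evolve u t G j)
  evolve-linear a b F G zero    j = refl
  evolve-linear a b F G (suc t) j =
    trans (mutate-cong (evolve-linear a b F G t) j) (mutate-linear a b (evolve u t F) (evolve u t G) j)

  evolve-fixes : ∀ {t j} F → ¬ Occurs u t j → evolve u t F j ≡ F j
  evolve-fixes {zero}      F _    = refl
  evolve-fixes {suc t} {j} F ¬occ =
    trans (mutate-minimal (evolve u t F) j≢ut) (evolve-fixes F (¬occ ∘ occurs-earlier))
    where
    j≢ut : j ≢ u t
    j≢ut j≡ut = ¬occ (t , ℕ.≤-refl , sym j≡ut)
    occurs-earlier : Occurs u t j → Occurs u (suc t) j
    occurs-earlier (t′ , t′<t , eq) = t′ , ℕ.m<n⇒m<1+n t′<t , eq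

evolve-+ : ∀ {n} (w : ℕ → Fin (suc n)) s d F →
           evolve w (s ℕ.+ d) F ≗ evolve (w ∘ (s ℕ.+_)) d (evolve w s F)
evolve-+ w s zero    F j = cong (λ t → evolve w t F j) (ℕ.+-identityʳ s)
evolve-+ w s (suc d) F j = trans (cong (λ t → evolve w t F j) (ℕ.+-suc s d))
                                 (mutate-cong (evolve-+ w s d F) j)

module _ {n : ℕ} (u : ℕ → Fin (suc n)) (d : ℕ)
         (I : Vector ℚ (suc n) → Set) (P : ℚ → Set)
         (step : ∀ {t F} → t ℕ.< d → I F → I (mutate (u t) F) × P (sum (removeAt F (u t))))
         where

  mutated-satisfy : ∀ {F} → I F → ∀ {j} → Occurs u d j → P (evolve u d F j)
  mutated-satisfy {F} I-F = proj₂ (go d ℕ.≤-refl)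
    where
    go : ∀ t → t ℕ.≤ d → I (evolve u t F) × (∀ {j} → Occurs u t j → P (evolve u t F j))
    go zero    _   = I-F , λ { (_ , () , _) }
    go (suc t) t<d = proj₁ (step t<d I-t) , P-suc
      where
      IH = go t (ℕ.<⇒≤ t<d)
      I-t = proj₁ IH
      P-suc : ∀ {j} → Occurs u (suc t) j → P (mutate (u t) (evolve u t F) j)
      P-suc {j} occ with j ≟ u t
      ... | yes refl = proj₂ (step t<d I-t)
      ... | no  j≢ut = proj₂ IH (occurs-before-last occ j≢ut)

persist : ∀ {P : ℕ → Set} → (∀ {t} → P t → P (suc t)) → ∀ {s t} → s ℕ.≤ t → P s → P t
persist {P} step {s} s≤t Ps = go (ℕ.≤⇒≤′ s≤t)
  where
  go : ∀ {t} → s ℕ.≤′ t → P t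
  go ≤′-refl        = Ps
  go (≤′-step s≤′t) = step (go s≤′t)

-- Brackets and sweeps

record Bracket {n} (a b : ℚ) (X Y : Vector ℚ n) : Set where
  constructor bracket
  field
    lower : a *ᵛ X ≤ᵛ Y
    upper : Y ≤ᵛ b *ᵛ X

mutate-bracket : ∀ {n a b} {X Y : Vector ℚ (suc n)} {i} →
                 Bracket a b X Y → Bracket a b (mutate i X) (mutate i Y)
mutate-bracket {a = a} {b} {X} (bracket aX≤Y Y≤bX) = bracket
  (λ j → ≤-trans (≤-reflexive (sym (mutate-* a X j))) (mutate-mono aX≤Y j))
  (λ j → ≤-trans (mutate-mono Y≤bX j) (≤-reflexive (mutate-* b X j)))

bracket-resp : ∀ {n a b} {X X′ Y Y′ : Vector ℚ n} → X ≗ X′ → Y ≗ Y′ →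
               Bracket a b X Y → Bracket a b X′ Y′
bracket-resp {a = a} {b} X≗X′ Y≗Y′ (bracket aX≤Y Y≤bX) = bracket
  (λ j → subst₂ (λ x y → a * x ≤ y) (X≗X′ j) (Y≗Y′ j) (aX≤Y j))
  (λ j → subst₂ (λ x y → y ≤ b * x) (X≗X′ j) (Y≗Y′ j) (Y≤bX j))

module Sweep {n : ℕ} (u : ℕ → Fin (suc n)) (d : ℕ) (p : Fin (suc n))
             (p-fresh : ¬ Occurs u d p) (others-occur : ∀ j → j ≢ p → Occurs u d j)
             where

  mutated-≢p : ∀ {t} → t ℕ.< d → u t ≢ p
  mutated-≢p {t} t<d ut≡p = p-fresh (t , t<d , ut≡p)

  -- Invariant: G ≤ D, and D is nonnegative at every index mutated so far, because a mutation at
  -- i ≢ p produces at least the sum of the other coordinates of G, which is sum G - G i ≥ 0.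
  evolve-nonNeg : ∀ {G} → (∀ j → j ≢ p → G j ≤ 0ℚ) → 0ℚ ≤ G p → 0ℚ ≤ sum G →
                  ∀ j → 0ℚ ≤ evolve u d G j
  evolve-nonNeg {G} G≤0 0≤Gp 0≤ΣG j with j ≟ p
  ... | yes refl = ≤-trans 0≤Gp (≤-reflexive (sym (evolve-fixes u G p-fresh)))
  ... | no  j≢p  = mutated-satisfy u d (G ≤ᵛ_) (0ℚ ≤_) step (λ _ → ≤-refl) (others-occur j j≢p)
    where
    step : ∀ {t D} → t ℕ.< d → G ≤ᵛ D → G ≤ᵛ mutate (u t) D × 0ℚ ≤ sum (removeAt D (u t))
    step {t} {D} t<d G≤D = G≤mutated , 0≤new
      where
      open ≤-Reasoning
      i = u t
      Gi≤0 = G≤0 i (mutated-≢p t<d)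
      0≤new : 0ℚ ≤ sum (removeAt D i)
      0≤new = begin
        0ℚ                   ≤⟨ p≤q⇒0≤q-p (≤-trans Gi≤0 0≤ΣG) ⟩
        sum G - G i          ≡⟨ sum-removeAt G i ⟨
        sum (removeAt G i)   ≤⟨ sum-mono (G≤D ∘ punchIn i) ⟩
        sum (removeAt D i)   ∎
      G≤mutated : G ≤ᵛ mutate i D
      G≤mutated k with k ≟ i
      ... | yes refl = ≤-trans Gi≤0 0≤new
      ... | no  _    = G≤D k

  module _ {X : Vector ℚ (suc n)} (0≤X : ∀ j → 0ℚ ≤ X j) (heavy : X p ≡ sum (removeAt X p)) where

    H : Vector ℚ (suc n)
    H = updateAt X p (λ _ → 0ℚ)

    H-p : H p ≡ 0ℚ
    H-p = updateAt-updates p X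

    H-minimal : ∀ {j} → j ≢ p → H j ≡ X j
    H-minimal {j} j≢p = updateAt-minimal j p X j≢p

    ½X-H : Vector ℚ (suc n)
    ½X-H j = ½ * X j + (- 1ℚ) * H j

    ½X-H≤0 : ∀ j → j ≢ p → ½X-H j ≤ 0ℚ
    ½X-H≤0 j j≢p = begin
      ½ * X j + (- 1ℚ) * H j   ≡⟨ cong (λ h → ½ * X j + (- 1ℚ) * h) (H-minimal j≢p) ⟩
      ½ * X j + (- 1ℚ) * X j   ≡⟨ half-minus-one (X j) ⟩
      - (½ * X j)              ≤⟨ neg-antimono-≤ (nonNeg-* (nonNegative⁻¹ ½) (0≤X j)) ⟩
      0ℚ                       ∎
      where
      open ≤-Reasoning
      half-minus-one : ∀ x → ½ * x + (- 1ℚ) * x ≡ - (½ * x)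
      half-minus-one = solve-∀ ℚ-ring

    0≤½X-H-p : 0ℚ ≤ ½X-H p
    0≤½X-H-p = begin
      0ℚ                       ≤⟨ nonNeg-* (nonNegative⁻¹ ½) (0≤X p) ⟩
      ½ * X p                  ≡⟨ plus-zero (½ * X p) ⟨
      ½ * X p + (- 1ℚ) * 0ℚ    ≡⟨ cong (λ h → ½ * X p + (- 1ℚ) * h) H-p ⟨
      ½X-H p                   ∎
      where
      open ≤-Reasoning
      plus-zero : ∀ x → x + (- 1ℚ) * 0ℚ ≡ x
      plus-zero = solve-∀ ℚ-ring

    sum-½X-H : sum ½X-H ≡ 0ℚ
    sum-½X-H = begin
      sum ½X-H                                             ≡⟨ sum-linear ½ (- 1ℚ) X H ⟩
      ½ * sum X + (- 1ℚ) * sum H                           ≡⟨ cong₂ (λ x h → ½ * x + (- 1ℚ) * h)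
                                                                (sum-remove X) (sum-remove H) ⟩
      ½ * (X p + S) + (- 1ℚ) * (H p + sum (removeAt H p)) ≡⟨ cong₂ (λ x h → ½ * (x + S) + (- 1ℚ) * h)
                                                                heavy (cong₂ _+_ H-p sum-removeAt-H) ⟩
      ½ * (S + S) + (- 1ℚ) * (0ℚ + S)                      ≡⟨ halves S ⟩
      0ℚ                                                   ∎
      where
      open ≡-Reasoning
      S = sum (removeAt X p)
      sum-removeAt-H : sum (removeAt H p) ≡ S
      sum-removeAt-H = sum-cong-≗ (H-minimal ∘ punchInᵢ≢i p)
      halves : ∀ s → ½ * (s + s) + (- 1ℚ) * (0ℚ + s) ≡ 0ℚ
      halves = solve-∀ ℚ-ring

    evolve-H≤½X : ∀ j → evolve u d H j ≤ ½ * evolve u d X j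
    evolve-H≤½X j = 0≤q-p⇒p≤q (begin
      0ℚ                                               ≤⟨ evolve-nonNeg ½X-H≤0 0≤½X-H-p 0≤sum j ⟩
      evolve u d ½X-H j                                ≡⟨ evolve-linear u ½ (- 1ℚ) X H d j ⟩
      ½ * evolve u d X j + (- 1ℚ) * evolve u d H j     ≡⟨ minus-one (½ * evolve u d X j) (evolve u d H j) ⟩
      ½ * evolve u d X j - evolve u d H j              ∎)
      where
      open ≤-Reasoning
      0≤sum = ≤-reflexive (sym sum-½X-H)
      minus-one : ∀ a b → a + (- 1ℚ) * b ≡ a - b
      minus-one = solve-∀ ℚ-ring

    module _ {Y : Vector ℚ (suc n)} {v : ℚ} (Yp≡vXp : Y p ≡ v * X p) where

      blend : ℚ → Vector ℚ (suc n)
      blend c j = v * X j + (c - v) * H j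

      blend-p : ∀ c → blend c p ≡ Y p
      blend-p c = trans (cong (λ h → v * X p + (c - v) * h) H-p) (trans (plus-zero (v * X p) (c - v)) (sym Yp≡vXp))
        where
        plus-zero : ∀ x y → x + y * 0ℚ ≡ x
        plus-zero = solve-∀ ℚ-ring

      blend-minimal : ∀ c {j} → j ≢ p → blend c j ≡ c * X j
      blend-minimal c {j} j≢p = trans (cong (λ h → v * X j + (c - v) * h) (H-minimal j≢p)) (regroup v c (X j))
        where
        regroup : ∀ v c x → v * x + (c - v) * x ≡ c * x
        regroup = solve-∀ ℚ-ring

      evolve-blend : ∀ c j → evolve u d (blend c) j ≡ v * evolve u d X j + (c - v) * evolve u d H j
      evolve-blend c = evolve-linear u v (c - v) X H d

      midpoint : ∀ c x → v * x + (c - v) * (½ * x) ≡ ((c + v) * ½) * x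
      midpoint = identity v
        where
        identity : ∀ v c x → v * x + (c - v) * (½ * x) ≡ ((c + v) * ½) * x
        identity = solve-∀ ℚ-ring

      evolve-upper : ∀ {b} → v ≤ b → Y ≤ᵛ b *ᵛ X → evolve u d Y ≤ᵛ ((b + v) * ½) *ᵛ evolve u d X
      evolve-upper {b} v≤b Y≤bX j = begin
        evolve u d Y j                                      ≤⟨ evolve-mono u Y≤blend d j ⟩
        evolve u d (blend b) j                              ≡⟨ evolve-blend b j ⟩
        v * evolve u d X j + (b - v) * evolve u d H j       ≤⟨ +-monoʳ-≤ (v * evolve u d X j)
                                                                (*-monoˡ-≤-nonNeg (b - v) {{nonNegative (p≤q⇒0≤q-p v≤b)}}
                                                                  (evolve-H≤½X j)) ⟩
        v * evolve u d X j + (b - v) * (½ * evolve u d X j) ≡⟨ midpoint b (evolve u d X j) ⟩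
        ((b + v) * ½) * evolve u d X j                      ∎
        where
        open ≤-Reasoning
        Y≤blend : Y ≤ᵛ blend b
        Y≤blend k with k ≟ p
        ... | yes refl = ≤-reflexive (sym (blend-p b))
        ... | no  k≢p  = ≤-trans (Y≤bX k) (≤-reflexive (sym (blend-minimal b k≢p)))

      evolve-lower : ∀ {a} → a ≤ v → a *ᵛ X ≤ᵛ Y → ((a + v) * ½) *ᵛ evolve u d X ≤ᵛ evolve u d Y
      evolve-lower {a} a≤v aX≤Y j = begin
        ((a + v) * ½) * evolve u d X j                      ≡⟨ midpoint a (evolve u d X j) ⟨
        v * evolve u d X j + (a - v) * (½ * evolve u d X j) ≤⟨ +-monoʳ-≤ (v * evolve u d X j)
                                                                (*-monoˡ-≤-nonPos (a - v) {{nonPositive (p≤q⇒p-q≤0 a≤v)}}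
                                                                  (evolve-H≤½X j)) ⟩
        v * evolve u d X j + (a - v) * evolve u d H j       ≡⟨ evolve-blend a j ⟨
        evolve u d (blend a) j                              ≤⟨ evolve-mono u blend≤Y d j ⟩
        evolve u d Y j                                      ∎
        where
        open ≤-Reasoning
        blend≤Y : blend a ≤ᵛ Y
        blend≤Y k with k ≟ p
        ... | yes refl = ≤-reflexive (blend-p a)
        ... | no  k≢p  = ≤-trans (≤-reflexive (blend-minimal a k≢p)) (aX≤Y k)

    bracket-halves : ∀ {a b Y} → 0ℚ < X p → Bracket a b X Y →
                     ∃[ v ] Bracket ((a + v) * ½) ((b + v) * ½) (evolve u d X) (evolve u d Y)
    bracket-halves {a} {b} {Y} 0<Xp (bracket aX≤Y Y≤bX) =
      v , bracket (evolve-lower Yp≡vXp a≤v aX≤Y) (evolve-upper Yp≡vXp v≤b Y≤bX)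
      where
      instance
        Xp≢0 : NonZero (X p)
        Xp≢0 = >-nonZero 0<Xp
      v = Y p * 1/ X p
      Yp≡vXp : Y p ≡ v * X p
      Yp≡vXp = sym (trans (*-assoc (Y p) (1/ X p) (X p))
                          (trans (cong (Y p *_) (*-inverseˡ (X p))) (*-identityʳ (Y p))))
      a≤v : a ≤ v
      a≤v = *-cancelʳ-≤-pos (X p) {{positive 0<Xp}} (≤-trans (aX≤Y p) (≤-reflexive Yp≡vXp))
      v≤b : v ≤ b
      v≤b = *-cancelʳ-≤-pos (X p) {{positive 0<Xp}} (≤-trans (≤-reflexive (sym Yp≡vXp)) (Y≤bX p))

Large : ∀ {n} → ℚ → Vector ℚ n → Set
Large δ F = ∀ j → 1ℚ ≤ δ * F j

large⇒pos : ∀ {δ x} → 0ℚ ≤ δ → 1ℚ ≤ δ * x → 0ℚ < x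
large⇒pos {δ} {x} 0≤δ 1≤δx = ≰⇒> x≰0
  where
  x≰0 : ¬ x ≤ 0ℚ
  x≰0 x≤0 = <-irrefl refl (begin-strict
    1ℚ       ≤⟨ 1≤δx ⟩
    δ * x    ≤⟨ *-monoˡ-≤-nonNeg δ {{nonNegative 0≤δ}} x≤0 ⟩
    δ * 0ℚ   ≡⟨ *-zeroʳ δ ⟩
    0ℚ       <⟨ positive⁻¹ 1ℚ ⟩
    1ℚ       ∎)
    where open ≤-Reasoning

module _ {n : ℕ} {δ : ℚ} (0≤δ : 0ℚ ≤ δ) where

  1+1≤δ*sum-removeAt : ∀ {F : Vector ℚ (3 ℕ.+ n)} → Large δ F →
                       ∀ i → 1ℚ + 1ℚ ≤ δ * sum (removeAt F i)
  1+1≤δ*sum-removeAt {F} large i =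
    ≤-trans (1+1≤sum (large ∘ punchIn i)) (≤-reflexive (sym (*-distribˡ-sum δ (removeAt F i))))

  mutate-large : ∀ {F : Vector ℚ (3 ℕ.+ n)} {i} → Large δ F → Large δ (mutate i F)
  mutate-large {F} {i} large j with j ≟ i
  ... | yes _ = ≤-trans (p≤p+q (nonNegative⁻¹ 1ℚ)) (1+1≤δ*sum-removeAt large i)
  ... | no  _ = large j

  1+1≤δx⇒1≤½δx : ∀ {x} → 1ℚ + 1ℚ ≤ δ * x → 1ℚ ≤ ½ * δ * x
  1+1≤δx⇒1≤½δx {x} 2≤δx = ≤-trans (*-monoˡ-≤-nonNeg ½ 2≤δx) (≤-reflexive (sym (*-assoc ½ δ x)))

  large-doubles : ∀ {u : ℕ → Fin (3 ℕ.+ n)} {d p} → ¬ Occurs u d p → (∀ j → j ≢ p → Occurs u d j) →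
                  ∀ {F} → Large δ F → Large (½ * δ) (evolve u d (mutate p F))
  large-doubles {u} {d} {p} p-fresh others-occur {F} large j with j ≟ p
  ... | yes refl = 1+1≤δx⇒1≤½δx (≤-trans (1+1≤δ*sum-removeAt large p)
                     (≤-reflexive (cong (δ *_) (sym (trans (evolve-fixes u (mutate p F) p-fresh) (mutate-updates F))))))
  ... | no  j≢p  = mutated-satisfy u d (Large δ) (λ x → 1ℚ ≤ ½ * δ * x)
                     (λ _ large′ → mutate-large large′ , 1+1≤δx⇒1≤½δx (1+1≤δ*sum-removeAt large′ _))
                     (mutate-large large) (others-occur j j≢p)

-- Sweeps in a recurrent word

upper-bound : ∀ {n} (f : Fin n → ℕ) → ∃[ B ] (∀ j → f j ℕ.≤ B)
upper-bound {zero}  f = 0 , λ ()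
upper-bound {suc n} f with upper-bound (f ∘ suc)
... | B , f∘suc≤B = f zero ℕ.⊔ B , λ { zero    → ℕ.m≤m⊔n (f zero) B
                                       ; (suc j) → ℕ.≤-trans (f∘suc≤B j) (ℕ.m≤n⊔m (f zero) B) }

Recurrent : ∀ {n} → (ℕ → Fin n) → Set
Recurrent w = ∀ i t → ∃[ t′ ] t ℕ.≤ t′ × w t′ ≡ i

record SweepAfter {n} (w : ℕ → Fin n) (s : ℕ) : Set where
  field
    σ d          : ℕ
    s≤σ          : s ℕ.≤ σ
    fresh        : ¬ Occurs (w ∘ (suc σ ℕ.+_)) d (w σ)
    others-occur : ∀ j → j ≢ w σ → Occurs (w ∘ (suc σ ℕ.+_)) d j

module _ {n : ℕ} (w : ℕ → Fin (suc n)) where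

  Covers : ℕ → ℕ → Set
  Covers s d = ∀ j → Occurs (w ∘ (s ℕ.+_)) d j

  occurs? : ∀ s d j → Dec (Occurs (w ∘ (s ℕ.+_)) d j)
  occurs? s d j = ℕ.anyUpTo? (λ t → w (s ℕ.+ t) ≟ j) d

  occurs-split : ∀ {σ d j} → Occurs (w ∘ (σ ℕ.+_)) (suc d) j → w σ ≡ j ⊎ Occurs (w ∘ (suc σ ℕ.+_)) d j
  occurs-split {σ} (zero  , _       , eq) = inj₁ (trans (cong w (sym (ℕ.+-identityʳ σ))) eq)
  occurs-split {σ} (suc t , s≤s t<d , eq) = inj₂ (t , t<d , trans (cong w (sym (ℕ.+-suc σ t))) eq)

  last-cover : ∀ σ d → Covers σ (suc d) →
               ∃[ σ′ ] ∃[ d′ ] σ ℕ.≤ σ′ × Covers σ′ (suc d′) × ¬ Covers (suc σ′) d′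
  last-cover σ zero    cov = σ , zero , ℕ.≤-refl , cov , λ cov′ → nowhere (cov′ zero)
    where
    nowhere : ¬ Occurs (w ∘ (suc σ ℕ.+_)) 0 zero
    nowhere (_ , () , _)
  last-cover σ (suc d) cov with all? (occurs? (suc σ) (suc d))
  ... | no  ¬cov = σ , suc d , ℕ.≤-refl , cov , ¬cov
  ... | yes cov′ with last-cover (suc σ) d cov′
  ...   | σ′ , d′ , σ<σ′ , rest = σ′ , d′ , ℕ.<⇒≤ σ<σ′ , rest

  sweep-within : ∀ s d → Covers s (suc d) → SweepAfter w s
  sweep-within s d cov with last-cover s d cov
  ... | σ , d′ , s≤σ , cov-σ , ¬cov-suc-σ =
    record { σ = σ ; d = d′ ; s≤σ = s≤σ ; fresh = fresh ; others-occur = others-occur }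
    where
    missing = ¬∀⟶∃¬ (suc n) _ (occurs? (suc σ) d′) ¬cov-suc-σ
    wσ-missing : w σ ≡ proj₁ missing
    wσ-missing with occurs-split (cov-σ (proj₁ missing))
    ... | inj₁ eq  = eq
    ... | inj₂ occ = ⊥-elim (proj₂ missing occ)
    fresh : ¬ Occurs (w ∘ (suc σ ℕ.+_)) d′ (w σ)
    fresh occ = proj₂ missing (subst (Occurs (w ∘ (suc σ ℕ.+_)) d′) wσ-missing occ)
    others-occur : ∀ j → j ≢ w σ → Occurs (w ∘ (suc σ ℕ.+_)) d′ j
    others-occur j j≢wσ with occurs-split (cov-σ j)
    ... | inj₁ wσ≡j = ⊥-elim (j≢wσ (sym wσ≡j))
    ... | inj₂ occ  = occ

  sweep-after : Recurrent w → ∀ s → SweepAfter w s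
  sweep-after recurrent s = sweep-within s B cov
    where
    next : Fin (suc n) → ℕ
    next j = proj₁ (recurrent j s) ℕ.∸ s
    B = proj₁ (upper-bound next)
    cov : Covers s (suc B)
    cov j = next j , s≤s (proj₂ (upper-bound next) j) ,
            trans (cong w (ℕ.m+[n∸m]≡n (proj₁ (proj₂ (recurrent j s))))) (proj₂ (proj₂ (recurrent j s)))

-- Integer orbits as rational orbits

fromℕ-sumFin : ∀ {n} (z : Fin n → ℕ) → fromℕ (sumFin z) ≡ sum (fromℕ ∘ z)
fromℕ-sumFin {zero}  z = refl
fromℕ-sumFin {suc n} z =
  trans (fromℕ-+ (z zero) (sumFin (z ∘ suc))) (cong (fromℕ (z zero) +_) (fromℕ-sumFin (z ∘ suc)))

-- Defs.sumExcept sums a where-bound function that cannot be named from here; unifying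
-- sumFin g with sumExcept i z recovers it as g.
module _ {n : ℕ} (i : Fin n) (z : Fin n → ℕ) where

  summand : ∀ {g : Fin n → ℕ} → sumFin g ≡ sumExcept i z → Fin n → ℕ
  summand {g} _ = g

  omit : Fin n → ℕ
  omit = summand refl

  omit-i : omit i ≡ 0
  omit-i with i ≟ i
  ... | yes _   = refl
  ... | no  i≢i = ⊥-elim (i≢i refl)

  omit-minimal : ∀ {j} → j ≢ i → omit j ≡ z j
  omit-minimal {j} j≢i with j ≟ i
  ... | yes j≡i = ⊥-elim (j≢i j≡i)
  ... | no  _   = refl

fromℕ-sumExcept : ∀ {n} (i : Fin (suc n)) z → fromℕ (sumExcept i z) ≡ sum (removeAt (fromℕ ∘ z) i)
fromℕ-sumExcept i z = begin
  fromℕ (sumFin (omit i z))                                ≡⟨ fromℕ-sumFin (omit i z) ⟩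
  sum (fromℕ ∘ omit i z)                                   ≡⟨ sum-remove {i = i} (fromℕ ∘ omit i z) ⟩
  fromℕ (omit i z i) + sum (removeAt (fromℕ ∘ omit i z) i) ≡⟨ cong₂ _+_ (cong fromℕ (omit-i i z))
                                                                (sum-cong-≗ omit-removeAt) ⟩
  0ℚ + sum (removeAt (fromℕ ∘ z) i)                        ≡⟨ +-identityˡ _ ⟩
  sum (removeAt (fromℕ ∘ z) i)                             ∎
  where
  open ≡-Reasoning
  omit-removeAt : removeAt (fromℕ ∘ omit i z) i ≗ removeAt (fromℕ ∘ z) i
  omit-removeAt = cong fromℕ ∘ omit-minimal i z ∘ punchInᵢ≢i i

lift : ∀ {n} → ℚ → (Fin n → ℕ) → Vector ℚ n
lift c z j = fromℕ (z j) + c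

module _ {n k : ℕ} {c : ℚ} (k-balanced : fromℕ k + c ≡ fromℕ n * c) where

  lift-M : ∀ (i : Fin (suc n)) z → lift c (M i k z) ≗ mutate i (lift c z)
  lift-M i z j with j ≟ i
  ... | no  _ = refl
  ... | yes _ = begin
    fromℕ (sumExcept i z ℕ.+ k) + c                   ≡⟨ cong (_+ c) (fromℕ-+ (sumExcept i z) k) ⟩
    fromℕ (sumExcept i z) + fromℕ k + c               ≡⟨ +-assoc (fromℕ (sumExcept i z)) (fromℕ k) c ⟩
    fromℕ (sumExcept i z) + (fromℕ k + c)             ≡⟨ cong₂ _+_ (fromℕ-sumExcept i z) k-balanced ⟩
    S + fromℕ n * c                                   ≡⟨ cong (S +_) (sum-const n c) ⟨
    S + sum {n} (λ _ → c)                             ≡⟨ ∑-distrib-+ (removeAt (fromℕ ∘ z) i) (λ _ → c) ⟨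
    sum (removeAt (lift c z) i)                       ∎
    where
    open ≡-Reasoning
    S = sum (removeAt (fromℕ ∘ z) i)

  lift-orbit : ∀ (w : ℕ → Fin (suc n)) z t → lift c (orbit w k z t) ≗ evolve w t (lift c z)
  lift-orbit w z zero    j = refl
  lift-orbit w z (suc t) j = trans (lift-M (w t) (orbit w k z t) j) (mutate-cong (lift-orbit w z t) j)

ratio-within : ∀ {x y lo hi c δ} → 0ℚ ≤ c → 0ℚ ≤ δ → 1ℚ ≤ δ * fromℕ x →
               lo * fromℕ x ≤ fromℕ y + c → fromℕ y + c ≤ hi * fromℕ x → ratio y x ∈[ lo - c * δ , hi ]
ratio-within {x} {y} {lo} {hi} {c} {δ} 0≤c 0≤δ 1≤δx lox≤y+c y+c≤hix =
  *-cancelʳ-≤-pos (fromℕ x) {{positive 0<x}} lower , *-cancelʳ-≤-pos (fromℕ x) {{positive 0<x}} upper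
  where
  open ≤-Reasoning
  0<x : 0ℚ < fromℕ x
  0<x = large⇒pos 0≤δ 1≤δx
  ratio-x : ratio y x * fromℕ x ≡ fromℕ y
  ratio-x = ratio-*-fromℕ y x (ℕ.n≢0⇒n>0 λ { refl → <-irrefl refl 0<x })
  c≤cδx : c ≤ c * (δ * fromℕ x)
  c≤cδx = ≤-trans (≤-reflexive (sym (*-identityʳ c))) (*-monoˡ-≤-nonNeg c {{nonNegative 0≤c}} 1≤δx)
  expand : ∀ a c d x → (a - c * d) * x ≡ a * x - c * (d * x)
  expand = solve-∀ ℚ-ring
  cancel : ∀ a c → a + c - c ≡ a
  cancel = solve-∀ ℚ-ring
  upper : ratio y x * fromℕ x ≤ hi * fromℕ x
  upper = begin
    ratio y x * fromℕ x   ≡⟨ ratio-x ⟩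
    fromℕ y               ≤⟨ p≤p+q 0≤c ⟩
    fromℕ y + c           ≤⟨ y+c≤hix ⟩
    hi * fromℕ x          ∎
  lower : (lo - c * δ) * fromℕ x ≤ ratio y x * fromℕ x
  lower = begin
    (lo - c * δ) * fromℕ x             ≡⟨ expand lo c δ (fromℕ x) ⟩
    lo * fromℕ x - c * (δ * fromℕ x)   ≤⟨ +-monoʳ-≤ (lo * fromℕ x) (neg-antimono-≤ c≤cδx) ⟩
    lo * fromℕ x - c                   ≤⟨ +-monoˡ-≤ (- c) lox≤y+c ⟩
    fromℕ y + c - c                    ≡⟨ cancel (fromℕ y) c ⟩
    fromℕ y                            ≡⟨ ratio-x ⟨
    ratio y x * fromℕ x                ∎

-- The intervals of ratios

module Convergence {m : ℕ} (k : ℕ) (w : ℕ → Fin (3 ℕ.+ m)) (recurrent : Recurrent w)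
                   (x₀ y₀ : Fin (3 ℕ.+ m) → ℕ) (x₀-pos : ∀ j → 0 ℕ.< x₀ j) where

  c : ℚ
  c = ratio k (suc m)

  0≤c : 0ℚ ≤ c
  0≤c = nonNegative⁻¹ c {{normalize-nonNeg k (suc m)}}

  k-balanced : fromℕ k + c ≡ fromℕ (2 ℕ.+ m) * c
  k-balanced = begin
    fromℕ k + c                   ≡⟨ cong (_+ c) (ratio-*-fromℕ k (suc m) (s≤s z≤n)) ⟨
    c * fromℕ (suc m) + c         ≡⟨ regroup c (fromℕ (suc m)) ⟩
    (1ℚ + fromℕ (suc m)) * c      ≡⟨ cong (_* c) (fromℕ-+ 1 (suc m)) ⟨
    fromℕ (2 ℕ.+ m) * c           ∎
    where
    open ≡-Reasoning
    regroup : ∀ c a → c * a + c ≡ (1ℚ + a) * c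
    regroup = solve-∀ ℚ-ring

  X Y : ℕ → Vector ℚ (3 ℕ.+ m)
  X t = evolve w t (lift 0ℚ x₀)
  Y t = evolve w t (lift c y₀)

  X≡x : ∀ t j → X t j ≡ fromℕ (orbit w 0 x₀ t j)
  X≡x t j = trans (sym (lift-orbit {k = 0} {c = 0ℚ} (sym (*-zeroʳ (fromℕ (2 ℕ.+ m)))) w x₀ t j)) (+-identityʳ _)

  Y≡y+c : ∀ t j → Y t j ≡ fromℕ (orbit w k y₀ t j) + c
  Y≡y+c t j = sym (lift-orbit {c = c} k-balanced w y₀ t j)

  K : ℚ
  K = sum (lift c y₀)

  bracket-persists : ∀ {a b s t} → s ℕ.≤ t → Bracket a b (X s) (Y s) → Bracket a b (X t) (Y t)
  bracket-persists {a} {b} = persist {λ t → Bracket a b (X t) (Y t)} mutate-bracket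

  large-persists : ∀ {r s t} → s ℕ.≤ t → Large (½^ r) (X s) → Large (½^ r) (X t)
  large-persists {r} = persist {λ t → Large (½^ r) (X t)} (mutate-large (½^-nonNeg r))

  record Stage (r : ℕ) : Set where
    field
      W         : ℕ
      lo hi     : ℚ
      bracketed : Bracket lo hi (X W) (Y W)
      large     : Large (½^ r) (X W)
      narrow    : hi - lo ≤ K * ½^ r

  stage₀ : Stage 0
  stage₀ = record { W = 0 ; lo = 0ℚ ; hi = K ; bracketed = bracket lower upper ; large = large ; narrow = narrow }
    where
    open ≤-Reasoning
    0≤Y₀ : ∀ j → 0ℚ ≤ lift c y₀ j
    0≤Y₀ j = +-mono-≤ (fromℕ-nonNeg (y₀ j)) 0≤c
    1≤X₀ : ∀ j → 1ℚ ≤ lift 0ℚ x₀ j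
    1≤X₀ j = ≤-trans (1≤fromℕ (x₀-pos j)) (≤-reflexive (sym (+-identityʳ (fromℕ (x₀ j)))))
    lower : 0ℚ *ᵛ lift 0ℚ x₀ ≤ᵛ lift c y₀
    lower j = ≤-trans (≤-reflexive (*-zeroˡ (lift 0ℚ x₀ j))) (0≤Y₀ j)
    upper : lift c y₀ ≤ᵛ K *ᵛ lift 0ℚ x₀
    upper j = begin
      lift c y₀ j            ≤⟨ ≤-sum 0≤Y₀ j ⟩
      K                      ≡⟨ *-identityʳ K ⟨
      K * 1ℚ                 ≤⟨ *-monoˡ-≤-nonNeg K {{nonNegative (sum-nonNeg 0≤Y₀)}} (1≤X₀ j) ⟩
      K * lift 0ℚ x₀ j       ∎
    large : Large 1ℚ (lift 0ℚ x₀)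
    large j = ≤-trans (1≤X₀ j) (≤-reflexive (sym (*-identityˡ (lift 0ℚ x₀ j))))
    narrow : K - 0ℚ ≤ K * 1ℚ
    narrow = ≤-reflexive (trans (+-identityʳ K) (sym (*-identityʳ K)))

  stage-suc : ∀ {r} → Stage r → Stage (suc r)
  stage-suc {r} S = record
    { W         = suc σ ℕ.+ d
    ; lo        = (lo + v) * ½
    ; hi        = (hi + v) * ½
    ; bracketed = bracket-resp X-end Y-end (proj₂ halved)
    ; large     = λ j → subst (λ x → 1ℚ ≤ ½^ suc r * x) (X-end j)
                            (large-doubles (½^-nonNeg r) fresh others-occur large-σ j)
    ; narrow    = midpoints-narrow {lo} {hi} {K} {r} v narrow
    }
    where
    open Stage S
    open SweepAfter (sweep-after w recurrent W)
    u = w ∘ (suc σ ℕ.+_)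
    p = w σ
    open Sweep u d p fresh others-occur using (bracket-halves)

    large-σ : Large (½^ r) (X σ)
    large-σ = large-persists {r} s≤σ large

    0<X′ : ∀ j → 0ℚ < X (suc σ) j
    0<X′ j = large⇒pos (½^-nonNeg r) (mutate-large (½^-nonNeg r) large-σ j)

    heavy : X (suc σ) p ≡ sum (removeAt (X (suc σ)) p)
    heavy = trans (mutate-updates {i = p} (X σ)) (sym (sum-removeAt-mutate {i = p} (X σ)))

    halved : ∃[ v ] Bracket ((lo + v) * ½) ((hi + v) * ½) (evolve u d (X (suc σ))) (evolve u d (Y (suc σ)))
    halved = bracket-halves (<⇒≤ ∘ 0<X′) heavy (0<X′ p) (bracket-persists (ℕ.m≤n⇒m≤1+n s≤σ) bracketed)
    v = proj₁ halved

    X-end : evolve u d (X (suc σ)) ≗ X (suc σ ℕ.+ d)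
    X-end j = sym (evolve-+ w (suc σ) d (lift 0ℚ x₀) j)
    Y-end : evolve u d (Y (suc σ)) ≗ Y (suc σ ℕ.+ d)
    Y-end j = sym (evolve-+ w (suc σ) d (lift c y₀) j)

  stage : ∀ r → Stage r
  stage zero    = stage₀
  stage (suc r) = stage-suc (stage r)

  ratios : ℕ → Fin (3 ℕ.+ m) → ℚ
  ratios t j = ratio (orbit w k y₀ t j) (orbit w 0 x₀ t j)

  module _ {r : ℕ} (S : Stage r) where
    open Stage S

    ratios-within : ∀ {t} → W ℕ.≤ t → ∀ j → ratios t j ∈[ lo - c * ½^ r , hi ]
    ratios-within {t} W≤t j =
      ratio-within {lo = lo} {hi} 0≤c (½^-nonNeg r)
        (subst (λ x → 1ℚ ≤ ½^ r * x) (X≡x t j) (large-persists {r} W≤t large j))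
        (subst₂ (λ x y → lo * x ≤ y) (X≡x t j) (Y≡y+c t j) (Bracket.lower bracketed-t j))
        (subst₂ (λ x y → y ≤ hi * x) (X≡x t j) (Y≡y+c t j) (Bracket.upper bracketed-t j))
      where
      bracketed-t = bracket-persists W≤t bracketed

    width : hi - (lo - c * ½^ r) ≤ (K + c) * ½^ r
    width = begin
      hi - (lo - c * ½^ r)        ≡⟨ regroup hi lo c (½^ r) ⟩
      (hi - lo) + c * ½^ r        ≤⟨ +-monoˡ-≤ (c * ½^ r) narrow ⟩
      K * ½^ r + c * ½^ r         ≡⟨ *-distribʳ-+ (½^ r) K c ⟨
      (K + c) * ½^ r              ∎
      where
      open ≤-Reasoning
      regroup : ∀ a b c d → a - (b - c * d) ≡ (a - b) + c * d
      regroup = solve-∀ ℚ-ring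

corollary3p7 : (n : ℕ) → 3 ℕ.≤ n → (k : ℕ) → (w : ℕ → Fin n)
    → (∀ t → w (suc t) ≢ w t)
    → (∀ (i : Fin n) (t : ℕ) → Σ ℕ (λ t' → (t ℕ.≤ t') × (w t' ≡ i)))
    → (x0 y0 : Fin n → ℕ) → (∀ j → 0 ℕ.< x0 j)
    → (ε : ℚ) → 0ℚ < ε
    → Σ ℕ (λ T → ∀ t t' → T ℕ.≤ t → T ℕ.≤ t'
        → ∣ minFin (λ j → ratio (orbit w k y0 t j) (orbit w 0 x0 t j))
            - maxFin (λ j → ratio (orbit w k y0 t' j) (orbit w 0 x0 t' j)) ∣ < ε)
corollary3p7 (suc (suc (suc m))) (s≤s (s≤s (s≤s _))) k w _ recurrent x0 y0 x0-pos ε 0<ε =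
  W , λ t t′ W≤t W≤t′ → begin-strict
    ∣ minFin (ratios t) - maxFin (ratios t′) ∣
      ≤⟨ ∣-∣≤width (minFin-∈ (ratios-within S W≤t)) (maxFin-∈ (ratios-within S W≤t′)) ⟩
    hi - (lo - c * ½^ r)   ≤⟨ width S ⟩
    (K + c) * ½^ r         <⟨ proj₂ (archimedean (K + c) 0<ε) ⟩
    ε                      ∎
  where
  open Convergence k w recurrent x0 y0 x0-pos
  r = proj₁ (archimedean (K + c) 0<ε)
  S = stage r
  open Stage S
  open ≤-Reasoning
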